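{- Let $k,\ell,n$ be natural numbers such that $n\ge16$ and $\ell\le k\le n/(4\log n)$. Let $A$ be either a clause or a term over the variables of $\mathrm{ERPHP}^k_{n,k-1}$ and let $\rho$ be a random restriction sampled from the distribution $\mathcal D$. Then the pigeon-width of $A|_\rho$ is less than $\ell$ with probability at least $1-\dfrac{(4k\log n)^k}{n^{\ell}}$.
   Context: $\log$ is the binary logarithm; $[n]=\{1,\dots,n\}$, $[a,b]=\{a,\dots,b\}$. The 3-CNF formula $\mathrm{ERPHP}^k_{n,k-1}$ has variables $p_{u,v}$ ($u\in[k],v\in[n]$), $y_{u,v}$ ($u\in[k]$, $v\in[2,n-2]$), $r_v$ ($v\in[n]$), $r_{v,v'}$ ($v\ne v'\in[n]$), $q_{v,w}$ ($v\in[n],w\in[k-1]$), $z_{v,w}$ ($v\in[n]$, $w\in[k-3]$), and clauses: $p_{u,1}\lor p_{u,2}\lor y_{u,2}$ ($u\in[k]$); $\bar y_{u,v}\lor p_{u,v+1}\lor y_{u,v+1}$ ($u\in[k],v\in[2,n-3]$); $\bar y_{u,n-2}\lor p_{u,n-1}\lor p_{u,n}$ ($u\in[k]$); $\bar r_v\lor q_{v,1}\lor z_{v,1}$ ($v\in[n]$); $\bar z_{v,w}\lor q_{v,w+1}\lor z_{v,w+1}$ ($v\in[n],w\in[k-4]$); $\bar z_{v,k-3}\lor q_{v,k-2}\lor q_{v,k-1}$ ($v\in[n]$); $\bar p_{u,v}\lor\bar p_{u',v}$ ($u\ne u'\in[k],v\in[n]$); $\bar p_{u,v}\lor r_v$ ($u\in[k],v\in[n]$);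 $\bar r_v\lor\bar r_{v'}\lor r_{v,v'}$ ($v\ne v'\in[n]$); $\bar r_{v,v'}\lor\bar q_{v,w}\lor\bar q_{v',w}$ ($v\ne v'\in[n],w\in[k-1]$). The distribution $\mathcal D$ on partial assignments $\rho$ (true $=\top$, false $=\bot$): pick a $k$-element subset $S=\{v_1,\dots,v_k\}\subseteq[n]$ uniformly at random (its elements listed by a fixed rule) and set $r_v=\top$ for $v\in S$ and $r_v=\bot$ otherwise; $r_{v,v'}=r_v\land r_{v'}$; $p_{u,v_u}=\top$ and $p_{u,v}=\bot$ for $v\ne v_u$, for all $u\in[k]$; the $y_{u,v}$ set in some fixed way so as to satisfy the clauses containing $y$-variables; $q_{v,w},z_{v,w}$ left unset for $v\in S$; and for each $v\in[n]\setminus S$ an independent uniform bit $b_v\in\{\bot,\top\}$ is chosen and $q_{v,w}=z_{v,w}=b_v$ for all $w$. A term is a conjunction of literals. For a clause $A$, $A|_\rho$ is the trivially true clause (which mentions no pigeon) if $\rho$ makes some literal of $A$ true, and otherwise is $A$ with the literals falsified by $\rho$ removed; for a term $A$, $A|_\rho$ is the trivially false term (mentioning no pigeon) if $\rho$ falsifies some literal of $A$, and otherwise is $A$ with the literals made true by $\rho$ removed. The variables $q_{v,w},z_{v,w}$ (all $w$) mention the pigeon $v\in[n]$; the pigeon-width of a clause or term is the number of pigeons $v$ mentioned by some variable occurring in it. -}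

module Defs where

open import Data.Nat using (ℕ; zero; suc; _+_; _*_; _∸_; _^_; _≤_; _<_; _≡ᵇ_; _≤ᵇ_)
import Data.Nat as ℕ
open import Data.Bool using (Bool; true; false; not; _∧_; if_then_else_)
open import Data.Maybe using (Maybe; just; nothing)
open import Data.List using (List; []; _∷_; length; filterᵇ; concatMap; deduplicate; cartesianProduct; map; _++_)
open import Data.Bool.ListAction using (any)
open import Data.List.Relation.Unary.Any using (Any)
open import Data.Vec using (Vec; []; _∷_)
open import Data.Product using (_×_; _,_; proj₁; proj₂)
open import Relation.Binary.PropositionalEquality using (_≡_; _≢_)

-- Variables of ERPHP^k_{n,k-1}, with 1-based natural-number indices
-- exactly as in the paper; `ValidVar n k` says the indices are in range.

data Var : Set where
  p  : ℕ → ℕ → Var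
  y  : ℕ → ℕ → Var
  r  : ℕ → Var
  rr : ℕ → ℕ → Var
  q  : ℕ → ℕ → Var
  z  : ℕ → ℕ → Var

InRange : ℕ → ℕ → ℕ → Set
InRange a b x = a ≤ x × x ≤ b

ValidVar : ℕ → ℕ → Var → Set
ValidVar n k (p u v)    = InRange 1 k u × InRange 1 n v
ValidVar n k (y u v)    = InRange 1 k u × InRange 2 (n ∸ 2) v
ValidVar n k (r v)      = InRange 1 n v
ValidVar n k (rr v v')  = InRange 1 n v × InRange 1 n v' × v ≢ v'
ValidVar n k (q v w)    = InRange 1 n v × InRange 1 (k ∸ 1) w
ValidVar n k (z v w)    = InRange 1 n v × InRange 1 (k ∸ 3) w

Lit : Set
Lit = Var × Bool

-- A clause or a term is given by its list of literals.
data Kind : Set where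
  clause term : Kind

PAssign : Set
PAssign = Var → Maybe Bool

litVal : PAssign → Lit → Maybe Bool
litVal ρ (x , pol) with ρ x
... | nothing = nothing
... | just b  = just (if pol then b else not b)

isJust : Bool → Maybe Bool → Bool
isJust b nothing  = false
isJust b (just c) = if b then c else not c

satisfiedᵇ : PAssign → Lit → Bool
satisfiedᵇ ρ l = isJust true (litVal ρ l)

falsifiedᵇ : PAssign → Lit → Bool
falsifiedᵇ ρ l = isJust false (litVal ρ l)

-- A|ρ : nothing = the trivially true clause / trivially false term,
-- just B = the residual clause/term B.
restrict : Kind → PAssign → List Lit → Maybe (List Lit)
restrict clause ρ A = if any (satisfiedᵇ ρ) A then nothing
                      else just (filterᵇ (λ l → not (falsifiedᵇ ρ l)) A)
restrict term   ρ A = if any (falsifiedᵇ ρ) A then nothing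
                      else just (filterᵇ (λ l → not (satisfiedᵇ ρ l)) A)

pigeonsVar : Var → List ℕ
pigeonsVar (q v w) = v ∷ []
pigeonsVar (z v w) = v ∷ []
pigeonsVar _       = []

pigeonWidth : List Lit → ℕ
pigeonWidth A = length (deduplicate ℕ._≟_ (concatMap (λ l → pigeonsVar (proj₁ l)) A))

pwRestrict : Kind → PAssign → List Lit → ℕ
pwRestrict κ ρ A with restrict κ ρ A
... | nothing = 0
... | just B  = pigeonWidth B

-- The distribution D.
-- A subset S ⊆ [n] is a Vec Bool n; `at S v` is membership of the
-- 1-based element v (false outside [1,n]).

at : ∀ {n} → Vec Bool n → ℕ → Bool
at []       _             = false
at (x ∷ xs) zero          = false
at (x ∷ xs) (suc zero)    = x
at (x ∷ xs) (suc (suc m)) = at xs (suc m)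

ones : ∀ {n} → Vec Bool n → ℕ
ones []           = 0
ones (true ∷ xs)  = suc (ones xs)
ones (false ∷ xs) = ones xs

allVecs : ∀ n → List (Vec Bool n)
allVecs zero    = [] ∷ []
allVecs (suc n) = map (true ∷_) (allVecs n) ++ map (false ∷_) (allVecs n)

subsetsOfSize : ∀ n → ℕ → List (Vec Bool n)
subsetsOfSize n k = filterᵇ (λ S → ones S ≡ᵇ k) (allVecs n)

-- The restriction ρ determined by the subset S, the fixed listing rule
-- `lst` (lst S u = v_u), the fixed y-rule `yr`, and the bits b
-- (b_v = at b v; the bits for v ∈ S are ignored).
rho : ∀ {n} → (Vec Bool n → ℕ → ℕ) → (Vec Bool n → ℕ → ℕ → Bool) →
      Vec Bool n → Vec Bool n → PAssign
rho lst yr S b (p u v)   = just (lst S u ≡ᵇ v)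
rho lst yr S b (y u v)   = just (yr S u v)
rho lst yr S b (r v)     = just (at S v)
rho lst yr S b (rr v v') = just (at S v ∧ at S v')
rho lst yr S b (q v w)   = if at S v then nothing else just (at b v)
rho lst yr S b (z v w)   = if at S v then nothing else just (at b v)

ListingRule : ∀ n → ℕ → (Vec Bool n → ℕ → ℕ) → Set
ListingRule n k lst = ∀ (S : Vec Bool n) → ones S ≡ k →
  (∀ u → InRange 1 k u → InRange 1 n (lst S u) × at S (lst S u) ≡ true) ×
  (∀ u u' → InRange 1 k u → InRange 1 k u' → lst S u ≡ lst S u' → u ≡ u')

Sat : PAssign → List Lit → Set
Sat ρ C = Any (λ l → litVal ρ l ≡ just true) C

YClausesSat : ℕ → PAssign → ℕ → Set
YClausesSat n ρ u =
    Sat ρ ((p u 1 , true) ∷ (p u 2 , true) ∷ (y u 2 , true) ∷ [])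
  × (∀ v → InRange 2 (n ∸ 3) v →
       Sat ρ ((y u v , false) ∷ (p u (suc v) , true) ∷ (y u (suc v) , true) ∷ []))
  × Sat ρ ((y u (n ∸ 2) , false) ∷ (p u (n ∸ 1) , true) ∷ (p u n , true) ∷ [])


-- the y-rule satisfies all clauses of ERPHP containing y-variables
YRuleOK : ∀ n → ℕ → (Vec Bool n → ℕ → ℕ) → (Vec Bool n → ℕ → ℕ → Bool) → Set
YRuleOK n k lst yr = ∀ (S b : Vec Bool n) → ones S ≡ k → ∀ u → InRange 1 k u →
    YClausesSat n (rho lst yr S b) u

-- number of outcomes (S , b) of the sample space (uniform over k-subsets S
-- and b ∈ {⊥,⊤}^n) where the pigeon-width of A|ρ is at least ℓ
badCount : ∀ n k ℓ → (Vec Bool n → ℕ → ℕ) → (Vec Bool n → ℕ → ℕ → Bool) →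
           Kind → List Lit → ℕ
badCount n k ℓ lst yr κ A =
  length (filterᵇ (λ Sb → ℓ ≤ᵇ pwRestrict κ (rho lst yr (proj₁ Sb) (proj₂ Sb)) A)
                  (cartesianProduct (subsetsOfSize n k) (allVecs n)))

totalCount : ℕ → ℕ → ℕ
totalCount n k = length (subsetsOfSize n k) * 2 ^ n

-- `FracLeCLogPow a b c n k` means   a / b ≤ (c · log₂ n)^k   (b > 0, n ≥ 1),
-- expressed by a Dedekind-cut argument: every nonnegative rational
-- P/Q with (P/Q)^k · c^k < a/b satisfies P/Q ≤ log₂ n, i.e. 2^P ≤ n^Q.
FracLeCLogPow : ℕ → ℕ → ℕ → ℕ → ℕ → Set
FracLeCLogPow a b c n k =
  ∀ P Q → 1 ≤ Q → P ^ k * c ^ k * b < a * Q ^ k → 2 ^ P ≤ n ^ Q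

{-# OPTIONS --safe #-}

-- Let M be the set of pigeons mentioned by A and t = |M|.  Every pigeon mentioned by A|ρ lies
-- in S ∩ M, and a pigeon v ∈ M ∖ S has all its q- and z-variables set to the same bit b_v, so
-- A|ρ can be non-trivial only if every such b_v takes the one value that keeps the literals on
-- v undecided.  Hence, counting outcomes (S, b),
--   Pr[pw(A|ρ) ≥ ℓ] ≤ E 2^|S ∩ M| / 2^t ≤ 2^k / 2^t                    (ℓ ≥ 1),
--   Pr[pw(A|ρ) ≥ ℓ] ≤ E C(|S ∩ M|, ℓ) = C(t,ℓ) C(k,ℓ) / C(n,ℓ) ≤ 2^k (t/n)^ℓ.
-- If t ≥ k + ℓ log n the first bound is at most n^-ℓ; otherwise t < 2k log n and the second
-- is at most 2^k (2k log n)^ℓ / n^ℓ ≤ (4k log n)^k / n^ℓ.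
module Submission where

open import Defs

import Data.Nat as ℕ
open import Data.Bool using (Bool; true; false; not; _∧_; if_then_else_; T; T?)
open import Data.Bool.ListAction using (any)
open import Data.Bool.Properties using (_≟_; T-∧; T-≡; T-not-≡)
open import Data.Empty using (⊥-elim)
open import Data.Fin using (toℕ)
open import Data.Fin.Subset using (_∩_; ∁; ⊤)
open import Data.Fin.Subset.Properties using (∩-identityʳ)
open import Data.List using (List; []; _∷_; _++_; length; map; filterᵇ; cartesianProduct; concatMap; deduplicate)
open import Data.List.Membership.DecPropositional ℕ._≟_ using (_∈?_)
open import Data.List.Membership.Propositional using (_∈_)
open import Data.List.Membership.Propositional.Properties using (∈-map⁺; ∈-map⁻; ∈-concat⁻′; ∈-filter⁻; ∈-deduplicate⁻)
open import Data.List.Properties using (map-++; map-∘; length-map; length-removeAt′)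
open import Data.List.Relation.Unary.All using (All) renaming (lookup to All-lookup)
open import Data.List.Relation.Unary.AllPairs using ([]; _∷_)
open import Data.List.Relation.Unary.Any using (here; there; index; _─_)
import Data.List.Relation.Unary.Any as Any
open import Data.List.Relation.Unary.Any.Properties using (any⁺)
open import Data.List.Relation.Unary.Unique.DecPropositional.Properties ℕ._≟_ using (deduplicate-!)
open import Data.List.Relation.Unary.Unique.Propositional using (Unique)
open import Data.Maybe using (Maybe; just; nothing; is-just; maybe′)
open import Data.Nat using (ℕ; zero; suc; _+_; _*_; _∸_; _^_; _≤_; _<_; _≤ᵇ_; _≡ᵇ_; z≤n; s≤s; _≤?_; _<?_; >-nonZero)
open import Data.Nat.ListAction using (sum)
open import Data.Nat.ListAction.Properties using (sum-++)
open import Data.Nat.Properties hiding (_≟_)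
open import Algebra.Properties.CommutativeSemigroup +-commutativeSemigroup
  using () renaming (interchange to +-interchange)
open import Data.Nat.Solver using (module +-*-Solver)
open import Data.Product using (Σ; _×_; _,_; proj₁; proj₂)
open import Data.Unit using (tt)
open import Data.Vec using (Vec; []; _∷_; tabulate)
open import Function using (_∘_)
open import Function.Bundles using (Equivalence)
open import Relation.Binary.PropositionalEquality
open import Relation.Nullary using (Dec; yes; no; does; ¬_; contradiction)
open import Relation.Nullary.Decidable using (dec-true)

open +-*-Solver using (solve; _:+_; _:*_; _:=_; con)

-- Binomial coefficients

infix 8 _choose_

-- Pascal's rule as a definition, rather than the factorial-based
-- `Data.Nat.Combinatorics._C_`, so that it unfolds in the inductions below.
_choose_ : ℕ → ℕ → ℕ
n     choose zero  = 1
zero  choose suc k = 0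
suc n choose suc k = n choose k + n choose suc k

<⇒choose≡0 : ∀ {n k} → n < k → n choose k ≡ 0
<⇒choose≡0 {zero}  {suc k} _         = refl
<⇒choose≡0 {suc n} {suc k} (s≤s n<k) = cong₂ _+_ (<⇒choose≡0 n<k) (<⇒choose≡0 (m<n⇒m<1+n n<k))

choose>0 : ∀ {n k} → k ≤ n → 0 < n choose k
choose>0 {n}     {zero}  _         = ≤-refl
choose>0 {suc n} {suc k} (s≤s k≤n) = ≤-trans (choose>0 k≤n) (m≤m+n _ _)

choose≤2^ : ∀ n k → n choose k ≤ 2 ^ n
choose≤2^ n       zero    = m^n>0 2 n
choose≤2^ zero    (suc k) = z≤n
choose≤2^ (suc n) (suc k) = begin
  n choose k + n choose suc k ≤⟨ +-mono-≤ (choose≤2^ n k) (choose≤2^ n (suc k)) ⟩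
  2 ^ n + 2 ^ n               ≡⟨ cong (2 ^ n +_) (+-identityʳ (2 ^ n)) ⟨
  2 ^ suc n                   ∎
  where open ≤-Reasoning

choose-absorption : ∀ n k → n choose suc k * suc k + n choose k * k ≡ n choose k * n
choose-absorption zero    zero    = refl
choose-absorption zero    (suc k) = refl
choose-absorption (suc n) zero    = cong suc (choose-absorption n zero)
choose-absorption (suc n) (suc k) = begin
  (b + c) * (2 + k) + (a + b) * suc k
    ≡⟨ solve 4 (λ a b c k → (b :+ c) :* (con 2 :+ k) :+ (a :+ b) :* (con 1 :+ k)
                            := (c :* (con 2 :+ k) :+ b :* (con 1 :+ k)) :+ (b :* (con 1 :+ k) :+ a :* k) :+ a :+ b)
             refl a b c k ⟩
  (c * (2 + k) + b * suc k) + (b * suc k + a * k) + a + b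
    ≡⟨ cong (λ x → x + a + b) (cong₂ _+_ (choose-absorption n (suc k)) (choose-absorption n k)) ⟩
  b * n + a * n + a + b
    ≡⟨ solve 3 (λ a b n → b :* n :+ a :* n :+ a :+ b := (a :+ b) :* (con 1 :+ n)) refl a b n ⟩
  (a + b) * suc n ∎
  where
  open ≡-Reasoning
  a = n choose k
  b = n choose suc k
  c = n choose suc (suc k)

choose-suc-* : ∀ n k → n choose suc k * suc k ≡ n choose k * (n ∸ k)
choose-suc-* n k = begin
  n choose suc k * suc k                                ≡⟨ m+n∸n≡m _ (n choose k * k) ⟨
  n choose suc k * suc k + n choose k * k ∸ n choose k * k ≡⟨ cong (_∸ n choose k * k) (choose-absorption n k) ⟩
  n choose k * n ∸ n choose k * k                        ≡⟨ *-distribˡ-∸ (n choose k) n k ⟨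
  n choose k * (n ∸ k)                                   ∎
  where open ≡-Reasoning

∸-*-≤-*-∸ : ∀ {t n} k → t ≤ n → (t ∸ k) * n ≤ t * (n ∸ k)
∸-*-≤-*-∸ {t} {n} k t≤n = begin
  (t ∸ k) * n   ≡⟨ *-distribʳ-∸ n t k ⟩
  t * n ∸ k * n ≤⟨ ∸-monoʳ-≤ (t * n) (≤-trans (≤-reflexive (*-comm t k)) (*-monoʳ-≤ k t≤n)) ⟩
  t * n ∸ t * k ≡⟨ *-distribˡ-∸ t n k ⟨
  t * (n ∸ k)   ∎
  where open ≤-Reasoning

choose-*-^-≤ : ∀ {t n} k → t ≤ n → t choose k * n ^ k ≤ t ^ k * n choose k
choose-*-^-≤         zero    _   = ≤-refl
choose-*-^-≤ {t} {n} (suc k) t≤n = *-cancelʳ-≤ _ _ (suc k) (begin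
  t choose suc k * (n * n ^ k) * suc k
    ≡⟨ solve 4 (λ a b c d → a :* (b :* c) :* d := (a :* d) :* (b :* c)) refl (t choose suc k) n (n ^ k) (suc k) ⟩
  (t choose suc k * suc k) * (n * n ^ k)
    ≡⟨ cong (_* (n * n ^ k)) (choose-suc-* t k) ⟩
  t choose k * (t ∸ k) * (n * n ^ k)
    ≡⟨ solve 4 (λ a b c d → a :* b :* (c :* d) := (a :* d) :* (b :* c)) refl (t choose k) (t ∸ k) n (n ^ k) ⟩
  (t choose k * n ^ k) * ((t ∸ k) * n)
    ≤⟨ *-mono-≤ (choose-*-^-≤ k t≤n) (∸-*-≤-*-∸ k t≤n) ⟩
  (t ^ k * n choose k) * (t * (n ∸ k))
    ≡⟨ solve 4 (λ a b c d → (a :* b) :* (c :* d) := (c :* a) :* (b :* d)) refl (t ^ k) (n choose k) t (n ∸ k) ⟩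
  t ^ suc k * (n choose k * (n ∸ k))
    ≡⟨ cong (t ^ suc k *_) (choose-suc-* n k) ⟨
  t ^ suc k * (n choose suc k * suc k)
    ≡⟨ *-assoc (t ^ suc k) _ _ ⟨
  t ^ suc k * n choose suc k * suc k ∎)
  where open ≤-Reasoning

𝟙 : Bool → ℕ
𝟙 b = if b then 1 else 0

𝟙[≤ᵇ]-≤-choose : ∀ ℓ {j m} → j ≤ m → 𝟙 (ℓ ≤ᵇ j) ≤ m choose ℓ
𝟙[≤ᵇ]-≤-choose ℓ {j} j≤m with ℓ ≤ᵇ j in ℓ≤ᵇj
... | false = z≤n
... | true  = choose>0 (≤-trans (≤ᵇ⇒≤ ℓ j (Equivalence.from T-≡ ℓ≤ᵇj)) j≤m)

-- The number of k-subsets of [n] containing {1,…,ℓ}; zero when ℓ > n.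
containing : ℕ → ℕ → ℕ → ℕ
containing n       zero    k       = n choose k
containing zero    (suc ℓ) k       = 0
containing (suc n) (suc ℓ) zero    = 0
containing (suc n) (suc ℓ) (suc k) = containing n ℓ k

containing-zeroʳ : ∀ n ℓ → containing n (suc ℓ) zero ≡ 0
containing-zeroʳ zero    ℓ = refl
containing-zeroʳ (suc n) ℓ = refl

containing-pascal : ∀ {n ℓ} k → ℓ < n →
  containing n (suc ℓ) k + containing n (suc ℓ) (suc k) ≡ containing n ℓ k
containing-pascal {suc n} {zero}  zero    _         = refl
containing-pascal {suc n} {zero}  (suc k) _         = refl
containing-pascal {suc n} {suc ℓ} zero    _         = containing-zeroʳ n ℓ
containing-pascal {suc n} {suc ℓ} (suc k) (s≤s ℓ<n) = containing-pascal k ℓ<n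

choose-*-containing-pascal : ∀ {t n} ℓ k → t ≤ n →
  t choose suc ℓ * (containing n (suc ℓ) k + containing n (suc ℓ) (suc k)) ≡
  t choose suc ℓ * containing n ℓ k
choose-*-containing-pascal {t} {n} ℓ k t≤n with ℓ <? n
... | yes ℓ<n = cong (t choose suc ℓ *_) (containing-pascal k ℓ<n)
... | no  ℓ≮n = trans (cong (_* _) C≡0) (sym (cong (_* _) C≡0))
  where C≡0 = <⇒choose≡0 (s≤s (≤-trans t≤n (≮⇒≥ ℓ≮n)))

ones-≤ : ∀ {n} (M : Vec Bool n) → ones M ≤ n
ones-≤ []          = z≤n
ones-≤ (true  ∷ M) = s≤s (ones-≤ M)
ones-≤ (false ∷ M) = m≤n⇒m≤1+n (ones-≤ M)

ones-⊤ : ∀ n → ones (⊤ {n}) ≡ n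
ones-⊤ zero    = refl
ones-⊤ (suc n) = cong suc (ones-⊤ n)

ones-∩-≤ : ∀ {n} (S M : Vec Bool n) → ones (S ∩ M) ≤ ones S
ones-∩-≤ []          []          = z≤n
ones-∩-≤ (true  ∷ S) (true  ∷ M) = s≤s (ones-∩-≤ S M)
ones-∩-≤ (true  ∷ S) (false ∷ M) = m≤n⇒m≤1+n (ones-∩-≤ S M)
ones-∩-≤ (false ∷ S) (_     ∷ M) = ones-∩-≤ S M

ones-split : ∀ {n} (S M : Vec Bool n) → ones M ≡ ones (S ∩ M) + ones (∁ S ∩ M)
ones-split []          []          = refl
ones-split (true  ∷ S) (true  ∷ M) = cong suc (ones-split S M)
ones-split (false ∷ S) (true  ∷ M) = trans (cong suc (ones-split S M)) (sym (+-suc _ _))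
ones-split (true  ∷ S) (false ∷ M) = ones-split S M
ones-split (false ∷ S) (false ∷ M) = ones-split S M

at-∩ : ∀ {n} (S M : Vec Bool n) v → at (S ∩ M) v ≡ at S v ∧ at M v
at-∩ []      []      v             = refl
at-∩ (s ∷ S) (m ∷ M) zero          = refl
at-∩ (s ∷ S) (m ∷ M) (suc zero)    = refl
at-∩ (s ∷ S) (m ∷ M) (suc (suc v)) = at-∩ S M (suc v)

at-tabulate : ∀ n (f : ℕ → Bool) {v} → InRange 1 n v → at (tabulate {n = n} (f ∘ suc ∘ toℕ)) v ≡ f v
at-tabulate (suc n) f {1}           _             = refl
at-tabulate (suc n) f {suc (suc v)} (_ , s≤s v≤n) = at-tabulate n (f ∘ suc) (s≤s z≤n , v≤n)

support : ∀ {n} → Vec Bool n → List ℕ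
support []          = []
support (true  ∷ D) = 1 ∷ map suc (support D)
support (false ∷ D) = map suc (support D)

length-support : ∀ {n} (D : Vec Bool n) → length (support D) ≡ ones D
length-support []          = refl
length-support (true  ∷ D) = cong suc (trans (length-map suc (support D)) (length-support D))
length-support (false ∷ D) = trans (length-map suc (support D)) (length-support D)

∈-support : ∀ {n} (D : Vec Bool n) {v} → InRange 1 n v → at D v ≡ true → v ∈ support D
∈-support (true  ∷ D) {1}           _            _  = here refl
∈-support (true  ∷ D) {suc (suc v)} (_ , s≤s v≤n) eq = there (∈-map⁺ suc (∈-support D (s≤s z≤n , v≤n) eq))
∈-support (false ∷ D) {suc (suc v)} (_ , s≤s v≤n) eq = ∈-map⁺ suc (∈-support D (s≤s z≤n , v≤n) eq)

-- Sums over the subsets of [n]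

sumOfSize : ∀ n → ℕ → (Vec Bool n → ℕ) → ℕ
sumOfSize zero    zero    f = f []
sumOfSize zero    (suc k) f = 0
sumOfSize (suc n) zero    f = sumOfSize n zero (f ∘ (false ∷_))
sumOfSize (suc n) (suc k) f = sumOfSize n k (f ∘ (true ∷_)) + sumOfSize n (suc k) (f ∘ (false ∷_))

sumOfSize-mono : ∀ n k {f g : Vec Bool n → ℕ} → (∀ S → ones S ≡ k → f S ≤ g S) →
  sumOfSize n k f ≤ sumOfSize n k g
sumOfSize-mono zero    zero    f≤g = f≤g [] refl
sumOfSize-mono zero    (suc k) f≤g = z≤n
sumOfSize-mono (suc n) zero    f≤g = sumOfSize-mono n zero (f≤g ∘ (false ∷_))
sumOfSize-mono (suc n) (suc k) f≤g =
  +-mono-≤ (sumOfSize-mono n k (λ S eq → f≤g (true ∷ S) (cong suc eq)))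
           (sumOfSize-mono n (suc k) (f≤g ∘ (false ∷_)))

sumOfSize-cong : ∀ n k {f g : Vec Bool n → ℕ} → (∀ S → ones S ≡ k → f S ≡ g S) →
  sumOfSize n k f ≡ sumOfSize n k g
sumOfSize-cong n k f≡g = ≤-antisym (sumOfSize-mono n k (λ S eq → ≤-reflexive (f≡g S eq)))
                                   (sumOfSize-mono n k (λ S eq → ≤-reflexive (sym (f≡g S eq))))

sumOfSize-+ : ∀ n k (f g : Vec Bool n → ℕ) →
  sumOfSize n k (λ S → f S + g S) ≡ sumOfSize n k f + sumOfSize n k g
sumOfSize-+ zero    zero    f g = refl
sumOfSize-+ zero    (suc k) f g = refl
sumOfSize-+ (suc n) zero    f g = sumOfSize-+ n zero _ _
sumOfSize-+ (suc n) (suc k) f g = begin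
  sumOfSize n k (λ S → f (true ∷ S) + g (true ∷ S)) + sumOfSize n (suc k) (λ S → f (false ∷ S) + g (false ∷ S))
    ≡⟨ cong₂ _+_ (sumOfSize-+ n k _ _) (sumOfSize-+ n (suc k) _ _) ⟩
  (a + b) + (c + d)
    ≡⟨ +-interchange a b c d ⟩
  (a + c) + (b + d) ∎
  where
  open ≡-Reasoning
  a = sumOfSize n k (f ∘ (true ∷_))
  b = sumOfSize n k (g ∘ (true ∷_))
  c = sumOfSize n (suc k) (f ∘ (false ∷_))
  d = sumOfSize n (suc k) (g ∘ (false ∷_))

sumOfSize-*ʳ : ∀ n k (f : Vec Bool n → ℕ) c → sumOfSize n k f * c ≡ sumOfSize n k (λ S → f S * c)
sumOfSize-*ʳ zero    zero    f c = refl
sumOfSize-*ʳ zero    (suc k) f c = refl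
sumOfSize-*ʳ (suc n) zero    f c = sumOfSize-*ʳ n zero _ c
sumOfSize-*ʳ (suc n) (suc k) f c =
  trans (*-distribʳ-+ c (sumOfSize n k _) _) (cong₂ _+_ (sumOfSize-*ʳ n k _ c) (sumOfSize-*ʳ n (suc k) _ c))

sumOfSize-const : ∀ n k c → sumOfSize n k (λ _ → c) ≡ c * n choose k
sumOfSize-const zero    zero    c = sym (*-identityʳ c)
sumOfSize-const zero    (suc k) c = sym (*-zeroʳ c)
sumOfSize-const (suc n) zero    c = sumOfSize-const n zero c
sumOfSize-const (suc n) (suc k) c =
  trans (cong₂ _+_ (sumOfSize-const n k c) (sumOfSize-const n (suc k) c)) (sym (*-distribˡ-+ c _ _))

-- Both sides count the pairs (S, T) with T ⊆ S ∩ M, |S| = k and |T| = ℓ.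
sumOfSize-choose-∩ : ∀ n k ℓ (M : Vec Bool n) →
  sumOfSize n k (λ S → ones (S ∩ M) choose ℓ) ≡ ones M choose ℓ * containing n ℓ k

sumOfSize-choose-∩-pascal : ∀ n k ℓ (M : Vec Bool n) →
  sumOfSize n k (λ S → ones (S ∩ M) choose suc ℓ) + sumOfSize n (suc k) (λ S → ones (S ∩ M) choose suc ℓ) ≡
  ones M choose suc ℓ * containing n ℓ k
sumOfSize-choose-∩-pascal n k ℓ M = begin
  sumOfSize n k (λ S → ones (S ∩ M) choose suc ℓ) + sumOfSize n (suc k) (λ S → ones (S ∩ M) choose suc ℓ)
    ≡⟨ cong₂ _+_ (sumOfSize-choose-∩ n k (suc ℓ) M) (sumOfSize-choose-∩ n (suc k) (suc ℓ) M) ⟩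
  ones M choose suc ℓ * containing n (suc ℓ) k + ones M choose suc ℓ * containing n (suc ℓ) (suc k)
    ≡⟨ *-distribˡ-+ (ones M choose suc ℓ) _ _ ⟨
  ones M choose suc ℓ * (containing n (suc ℓ) k + containing n (suc ℓ) (suc k))
    ≡⟨ choose-*-containing-pascal ℓ k (ones-≤ M) ⟩
  ones M choose suc ℓ * containing n ℓ k ∎
  where open ≡-Reasoning

sumOfSize-choose-∩ n       k       zero    M           = sumOfSize-const n k 1
sumOfSize-choose-∩ zero    zero    (suc ℓ) []          = refl
sumOfSize-choose-∩ zero    (suc k) (suc ℓ) []          = refl
sumOfSize-choose-∩ (suc n) zero    (suc ℓ) (m ∷ M)     = begin
  sumOfSize n zero (λ S → ones (S ∩ M) choose suc ℓ) ≡⟨ sumOfSize-choose-∩ n zero (suc ℓ) M ⟩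
  ones M choose suc ℓ * containing n (suc ℓ) zero     ≡⟨ cong (ones M choose suc ℓ *_) (containing-zeroʳ n ℓ) ⟩
  ones M choose suc ℓ * 0                             ≡⟨ *-zeroʳ (ones M choose suc ℓ) ⟩
  0                                                   ≡⟨ *-zeroʳ (ones (m ∷ M) choose suc ℓ) ⟨
  ones (m ∷ M) choose suc ℓ * 0                       ∎
  where open ≡-Reasoning
sumOfSize-choose-∩ (suc n) (suc k) (suc ℓ) (false ∷ M) = sumOfSize-choose-∩-pascal n k ℓ M
sumOfSize-choose-∩ (suc n) (suc k) (suc ℓ) (true  ∷ M) = begin
  sumOfSize n k (λ S → ones (S ∩ M) choose ℓ + ones (S ∩ M) choose suc ℓ) + F (suc k) (suc ℓ)
    ≡⟨ cong (_+ F (suc k) (suc ℓ)) (sumOfSize-+ n k _ _) ⟩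
  F k ℓ + F k (suc ℓ) + F (suc k) (suc ℓ)
    ≡⟨ +-assoc (F k ℓ) _ _ ⟩
  F k ℓ + (F k (suc ℓ) + F (suc k) (suc ℓ))
    ≡⟨ cong₂ _+_ (sumOfSize-choose-∩ n k ℓ M) (sumOfSize-choose-∩-pascal n k ℓ M) ⟩
  ones M choose ℓ * containing n ℓ k + ones M choose suc ℓ * containing n ℓ k
    ≡⟨ *-distribʳ-+ (containing n ℓ k) (ones M choose ℓ) _ ⟨
  suc (ones M) choose suc ℓ * containing n ℓ k ∎
  where
  open ≡-Reasoning
  F : ℕ → ℕ → ℕ
  F k ℓ = sumOfSize n k (λ S → ones (S ∩ M) choose ℓ)

choose-*-containing : ∀ n k ℓ → n choose ℓ * containing n ℓ k ≡ k choose ℓ * n choose k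
choose-*-containing n k ℓ = begin
  n choose ℓ * containing n ℓ k
    ≡⟨ cong (λ m → m choose ℓ * containing n ℓ k) (ones-⊤ n) ⟨
  ones (⊤ {n}) choose ℓ * containing n ℓ k
    ≡⟨ sumOfSize-choose-∩ n k ℓ ⊤ ⟨
  sumOfSize n k (λ S → ones (S ∩ ⊤) choose ℓ)
    ≡⟨ sumOfSize-cong n k (λ S |S|≡k → cong (_choose ℓ) (trans (cong ones (∩-identityʳ S)) |S|≡k)) ⟩
  sumOfSize n k (λ _ → k choose ℓ)
    ≡⟨ sumOfSize-const n k (k choose ℓ) ⟩
  k choose ℓ * n choose k ∎
  where open ≡-Reasoning

sumOfSize-choose-∩-≤ : ∀ n k ℓ (M : Vec Bool n) →
  sumOfSize n k (λ S → ones (S ∩ M) choose ℓ) * n ^ ℓ ≤ ones M ^ ℓ * 2 ^ k * n choose k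
sumOfSize-choose-∩-≤ n k ℓ M = begin
  sumOfSize n k (λ S → ones (S ∩ M) choose ℓ) * n ^ ℓ
    ≡⟨ cong (_* n ^ ℓ) (sumOfSize-choose-∩ n k ℓ M) ⟩
  t choose ℓ * containing n ℓ k * n ^ ℓ
    ≡⟨ solve 3 (λ a b c → a :* b :* c := (a :* c) :* b) refl (t choose ℓ) (containing n ℓ k) (n ^ ℓ) ⟩
  t choose ℓ * n ^ ℓ * containing n ℓ k
    ≤⟨ *-monoˡ-≤ (containing n ℓ k) (choose-*-^-≤ ℓ (ones-≤ M)) ⟩
  t ^ ℓ * n choose ℓ * containing n ℓ k
    ≡⟨ trans (*-assoc (t ^ ℓ) _ _) (cong (t ^ ℓ *_) (choose-*-containing n k ℓ)) ⟩
  t ^ ℓ * (k choose ℓ * n choose k)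
    ≤⟨ *-monoʳ-≤ (t ^ ℓ) (*-monoˡ-≤ (n choose k) (choose≤2^ k ℓ)) ⟩
  t ^ ℓ * (2 ^ k * n choose k)
    ≡⟨ *-assoc (t ^ ℓ) _ _ ⟨
  t ^ ℓ * 2 ^ k * n choose k ∎
  where
  open ≤-Reasoning
  t = ones M

sumAll : ∀ n → (Vec Bool n → ℕ) → ℕ
sumAll zero    f = f []
sumAll (suc n) f = sumAll n (f ∘ (true ∷_)) + sumAll n (f ∘ (false ∷_))

sumAll-mono : ∀ n {f g : Vec Bool n → ℕ} → (∀ b → f b ≤ g b) → sumAll n f ≤ sumAll n g
sumAll-mono zero    f≤g = f≤g []
sumAll-mono (suc n) f≤g = +-mono-≤ (sumAll-mono n (f≤g ∘ (true ∷_))) (sumAll-mono n (f≤g ∘ (false ∷_)))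

sumAll-const : ∀ n c → sumAll n (λ _ → c) ≡ c * 2 ^ n
sumAll-const zero    c = sym (*-identityʳ c)
sumAll-const (suc n) c = begin
  sumAll n (λ _ → c) + sumAll n (λ _ → c) ≡⟨ cong₂ _+_ (sumAll-const n c) (sumAll-const n c) ⟩
  c * 2 ^ n + c * 2 ^ n                   ≡⟨ *-distribˡ-+ c (2 ^ n) _ ⟨
  c * (2 ^ n + 2 ^ n)                     ≡⟨ cong (λ x → c * (2 ^ n + x)) (+-identityʳ (2 ^ n)) ⟨
  c * 2 ^ suc n                           ∎
  where open ≡-Reasoning

sumAll-if-ones : ∀ n k (f : Vec Bool n → ℕ) →
  sumAll n (λ S → if ones S ≡ᵇ k then f S else 0) ≡ sumOfSize n k f
sumAll-if-ones zero    zero    f = refl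
sumAll-if-ones zero    (suc k) f = refl
sumAll-if-ones (suc n) zero    f = cong₂ _+_ (sumAll-const n 0) (sumAll-if-ones n zero _)
sumAll-if-ones (suc n) (suc k) f = cong₂ _+_ (sumAll-if-ones n k _) (sumAll-if-ones n (suc k) _)

count : ∀ n → (Vec Bool n → Bool) → ℕ
count n φ = sumAll n (𝟙 ∘ φ)

count-mono : ∀ n {φ ψ : Vec Bool n → Bool} → (∀ b → T (φ b) → T (ψ b)) → count n φ ≤ count n ψ
count-mono n {φ} {ψ} φ⇒ψ = sumAll-mono n 𝟙-mono
  where
  𝟙-mono : ∀ b → 𝟙 (φ b) ≤ 𝟙 (ψ b)
  𝟙-mono b with φ b | ψ b | φ⇒ψ b
  ... | false | _     | _      = z≤n
  ... | true  | true  | _      = ≤-refl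
  ... | true  | false | φ⇒ψ[b] = ⊥-elim (φ⇒ψ[b] tt)

agreesOn : ∀ {n} → Vec Bool n → Vec Bool n → Vec Bool n → Bool
agreesOn []          []      []      = true
agreesOn (false ∷ D) (_ ∷ C) (_ ∷ b) = agreesOn D C b
agreesOn (true  ∷ D) (c ∷ C) (x ∷ b) = does (x ≟ c) ∧ agreesOn D C b

count-agreesOn : ∀ {n} (D C : Vec Bool n) → count n (agreesOn D C) * 2 ^ ones D ≡ 2 ^ n
count-agreesOn []          []      = refl
count-agreesOn {suc n} (false ∷ D) (c ∷ C) = begin
  (x + x) * w     ≡⟨ *-distribʳ-+ w x x ⟩
  x * w + x * w   ≡⟨ cong₂ _+_ (count-agreesOn D C) (count-agreesOn D C) ⟩
  2 ^ n + 2 ^ n   ≡⟨ cong (2 ^ n +_) (+-identityʳ (2 ^ n)) ⟨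
  2 ^ suc n       ∎
  where
  open ≡-Reasoning
  x = count n (agreesOn D C)
  w = 2 ^ ones D
count-agreesOn {suc n} (true ∷ D) (c ∷ C) = begin
  count (suc n) (agreesOn (true ∷ D) (c ∷ C)) * (2 * w) ≡⟨ cong (_* (2 * w)) (count-pinned c) ⟩
  x * (2 * w)                                         ≡⟨ *-comm x (2 * w) ⟩
  2 * w * x                                           ≡⟨ *-assoc 2 w x ⟩
  2 * (w * x)                                         ≡⟨ cong (2 *_) (trans (*-comm w x) (count-agreesOn D C)) ⟩
  2 ^ suc n                                           ∎
  where
  open ≡-Reasoning
  x = count n (agreesOn D C)
  w = 2 ^ ones D
  count-pinned : ∀ c → count (suc n) (agreesOn (true ∷ D) (c ∷ C)) ≡ x
  count-pinned true  = trans (cong (x +_) (sumAll-const n 0)) (+-identityʳ x)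
  count-pinned false = cong (_+ x) (sumAll-const n 0)

agreesOn-∁∩-intro : ∀ {n} (S M C b : Vec Bool n) →
  (∀ v → InRange 1 n v → at S v ≡ false → at M v ≡ true → at b v ≡ at C v) →
  T (agreesOn (∁ S ∩ M) C b)
agreesOn-∁∩-intro []      []      []      []      _ = tt
agreesOn-∁∩-intro (s ∷ S) (m ∷ M) (c ∷ C) (x ∷ b) h =
  agreesOn-∷ s m (h 1 (s≤s z≤n , s≤s z≤n))
    (agreesOn-∁∩-intro S M C b (λ { (suc v) (_ , 1+v≤1+n) → h (suc (suc v)) (s≤s z≤n , s≤s 1+v≤1+n) }))
  where
  agreesOn-∷ : ∀ s m → (s ≡ false → m ≡ true → x ≡ c) → T (agreesOn (∁ S ∩ M) C b) →
    T (agreesOn (∁ (s ∷ S) ∩ (m ∷ M)) (c ∷ C) (x ∷ b))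
  agreesOn-∷ true  _     _    rest = rest
  agreesOn-∷ false false _    rest = rest
  agreesOn-∷ false true  head rest =
    Equivalence.from T-∧ (Equivalence.from T-≡ (dec-true (x ≟ c) (head refl refl)) , rest)

-- Counting the sample space

module _ {A : Set} where

  length-filterᵇ : ∀ (φ : A → Bool) xs → length (filterᵇ φ xs) ≡ sum (map (𝟙 ∘ φ) xs)
  length-filterᵇ φ []       = refl
  length-filterᵇ φ (x ∷ xs) with φ x
  ... | true  = cong suc (length-filterᵇ φ xs)
  ... | false = length-filterᵇ φ xs

  sum-map-filterᵇ : ∀ (φ : A → Bool) (f : A → ℕ) xs →
    sum (map f (filterᵇ φ xs)) ≡ sum (map (λ x → if φ x then f x else 0) xs)
  sum-map-filterᵇ φ f []       = refl
  sum-map-filterᵇ φ f (x ∷ xs) with φ x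
  ... | true  = cong (f x +_) (sum-map-filterᵇ φ f xs)
  ... | false = sum-map-filterᵇ φ f xs

  sum-map-++ : ∀ (f : A → ℕ) xs ys → sum (map f (xs ++ ys)) ≡ sum (map f xs) + sum (map f ys)
  sum-map-++ f xs ys = trans (cong sum (map-++ f xs ys)) (sum-++ (map f xs) (map f ys))

sum-map-cartesianProduct : ∀ {A B : Set} (f : A × B → ℕ) xs ys →
  sum (map f (cartesianProduct xs ys)) ≡ sum (map (λ a → sum (map (λ b → f (a , b)) ys)) xs)
sum-map-cartesianProduct f []       ys = refl
sum-map-cartesianProduct f (x ∷ xs) ys = trans (sum-map-++ f (map (x ,_) ys) _)
  (cong₂ _+_ (cong sum (sym (map-∘ ys))) (sum-map-cartesianProduct f xs ys))

sum-map-allVecs : ∀ n (f : Vec Bool n → ℕ) → sum (map f (allVecs n)) ≡ sumAll n f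
sum-map-allVecs zero    f = +-identityʳ (f [])
sum-map-allVecs (suc n) f = trans (sum-map-++ f (map (true ∷_) (allVecs n)) _)
  (cong₂ _+_ (trans (cong sum (sym (map-∘ (allVecs n)))) (sum-map-allVecs n _))
             (trans (cong sum (sym (map-∘ (allVecs n)))) (sum-map-allVecs n _)))

length-subsetsOfSize : ∀ n k → length (subsetsOfSize n k) ≡ n choose k
length-subsetsOfSize n k = begin
  length (subsetsOfSize n k)                                ≡⟨ length-filterᵇ _ (allVecs n) ⟩
  sum (map (λ S → 𝟙 (ones S ≡ᵇ k)) (allVecs n))             ≡⟨ sum-map-allVecs n _ ⟩
  sumAll n (λ S → if ones S ≡ᵇ k then 1 else 0)             ≡⟨ sumAll-if-ones n k _ ⟩
  sumOfSize n k (λ _ → 1)                                   ≡⟨ sumOfSize-const n k 1 ⟩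
  1 * n choose k                                            ≡⟨ *-identityˡ _ ⟩
  n choose k                                                ∎
  where open ≡-Reasoning

length-filterᵇ-pairs : ∀ n k (φ : Vec Bool n × Vec Bool n → Bool) →
  length (filterᵇ φ (cartesianProduct (subsetsOfSize n k) (allVecs n))) ≡
  sumOfSize n k (λ S → count n (λ b → φ (S , b)))
length-filterᵇ-pairs n k φ = begin
  length (filterᵇ φ (cartesianProduct (subsetsOfSize n k) (allVecs n)))
    ≡⟨ length-filterᵇ φ (cartesianProduct (subsetsOfSize n k) (allVecs n)) ⟩
  sum (map (𝟙 ∘ φ) (cartesianProduct (subsetsOfSize n k) (allVecs n)))
    ≡⟨ sum-map-cartesianProduct (𝟙 ∘ φ) (subsetsOfSize n k) (allVecs n) ⟩
  sum (map countList (subsetsOfSize n k))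
    ≡⟨ sum-map-filterᵇ _ countList (allVecs n) ⟩
  sum (map (λ S → if ones S ≡ᵇ k then countList S else 0) (allVecs n))
    ≡⟨ sum-map-allVecs n _ ⟩
  sumAll n (λ S → if ones S ≡ᵇ k then countList S else 0)
    ≡⟨ sumAll-if-ones n k countList ⟩
  sumOfSize n k countList
    ≡⟨ sumOfSize-cong n k (λ S _ → sum-map-allVecs n _) ⟩
  sumOfSize n k (λ S → count n (λ b → φ (S , b))) ∎
  where
  open ≡-Reasoning
  countList : Vec Bool n → ℕ
  countList S = sum (map (λ b → 𝟙 (φ (S , b))) (allVecs n))

module _ {A : Set} where

  ∈-─ : ∀ {x y : A} {ys} (x∈ys : x ∈ ys) → y ∈ ys → x ≢ y → y ∈ (ys ─ x∈ys)
  ∈-─ (here refl)  (here refl)  x≢y = ⊥-elim (x≢y refl)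
  ∈-─ (here _)     (there y∈ys) _   = y∈ys
  ∈-─ (there _)    (here refl)  _   = here refl
  ∈-─ (there x∈ys) (there y∈ys) x≢y = there (∈-─ x∈ys y∈ys x≢y)

  Unique-length-≤ : ∀ {xs ys : List A} → Unique xs → (∀ {v} → v ∈ xs → v ∈ ys) → length xs ≤ length ys
  Unique-length-≤ {[]}     _               _      = z≤n
  Unique-length-≤ {x ∷ xs} {ys} (x∉xs ∷ xs!) xs⊆ys = begin
    suc (length xs)          ≤⟨ s≤s (Unique-length-≤ xs! v∈ys─x) ⟩
    suc (length (ys ─ x∈ys)) ≡⟨ length-removeAt′ ys (index x∈ys) ⟨
    length ys                ∎
    where
    open ≤-Reasoning
    x∈ys = xs⊆ys (here refl)
    v∈ys─x : ∀ {v} → v ∈ xs → v ∈ (ys ─ x∈ys)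
    v∈ys─x v∈xs = ∈-─ x∈ys (xs⊆ys (there v∈xs)) (All-lookup x∉xs v∈xs)

-- Restrictions

firstPolarityOn : ℕ → List Lit → Maybe Bool
firstPolarityOn v []              = nothing
firstPolarityOn v ((x , pol) ∷ A) = if does (v ∈? pigeonsVar x) then just pol else firstPolarityOn v A

firstPolarityOn-sound : ∀ v A {pol} → firstPolarityOn v A ≡ just pol →
  Σ Var λ x → (x , pol) ∈ A × v ∈ pigeonsVar x
firstPolarityOn-sound v ((x , pol) ∷ A) eq with v ∈? pigeonsVar x
firstPolarityOn-sound v ((x , pol) ∷ A) refl | yes v∈x = x , here refl , v∈x
... | no _ = let (x′ , x′∈A , v∈x′) = firstPolarityOn-sound v A eq in x′ , there x′∈A , v∈x′

firstPolarityOn-complete : ∀ v A {l} → l ∈ A → v ∈ pigeonsVar (proj₁ l) → is-just (firstPolarityOn v A) ≡ true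
firstPolarityOn-complete v ((x , pol) ∷ A) l∈A v∈l with v ∈? pigeonsVar x
... | yes _ = refl
firstPolarityOn-complete v ((x , pol) ∷ A) (here refl)  v∈x | no v∉x = ⊥-elim (v∉x v∈x)
firstPolarityOn-complete v ((x , pol) ∷ A) (there l∈A) v∈l | no _   = firstPolarityOn-complete v A l∈A v∈l

-- A literal value that trivialises A|ρ: true in a clause, false in a term.
decisive : Kind → Maybe Bool → Bool
decisive clause = isJust true
decisive term   = isJust false

-- The value of b_v under which a literal of polarity pol on a pigeon v ∉ S is not decisive.
survivingBit : Kind → Bool → Bool
survivingBit clause pol = not pol
survivingBit term   pol = pol

mentionedPigeons : ∀ n → List Lit → Vec Bool n
mentionedPigeons n A = tabulate (λ i → is-just (firstPolarityOn (suc (toℕ i)) A))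

survivingBits : ∀ n → Kind → List Lit → Vec Bool n
survivingBits n κ A = tabulate (λ i → maybe′ (survivingBit κ) false (firstPolarityOn (suc (toℕ i)) A))

mentioned⇒firstPolarity : ∀ {n} A {v} → InRange 1 n v → at (mentionedPigeons n A) v ≡ true →
  Σ Bool λ pol → firstPolarityOn v A ≡ just pol
mentioned⇒firstPolarity {n} A {v} v∈[n] M∋v
  with firstPolarityOn v A | trans (sym (at-tabulate n (λ v → is-just (firstPolarityOn v A)) v∈[n])) M∋v
... | just pol | _ = pol , refl

at-survivingBits : ∀ {n} κ A {v pol} → InRange 1 n v → firstPolarityOn v A ≡ just pol →
  at (survivingBits n κ A) v ≡ survivingBit κ pol
at-survivingBits {n} κ A v∈[n] eq =
  trans (at-tabulate n (λ v → maybe′ (survivingBit κ) false (firstPolarityOn v A)) v∈[n])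
        (cong (maybe′ (survivingBit κ) false) eq)

any-false : ∀ {X : Set} (φ : X → Bool) {xs} → any φ xs ≡ false → ∀ {x} → x ∈ xs → ¬ T (φ x)
any-false φ any≡false x∈xs φx = subst T any≡false (any⁺ φ (Any.map (λ { refl → φx }) x∈xs))

if-any-filterᵇ-just : ∀ {X : Set} (d o : X → Bool) xs {ys} →
  (if any d xs then nothing else just (filterᵇ (not ∘ o) xs)) ≡ just ys →
  (∀ {x} → x ∈ xs → ¬ T (d x)) × (∀ {x} → x ∈ ys → x ∈ xs × ¬ T (o x))
if-any-filterᵇ-just d o xs eq with any d xs in any≡
if-any-filterᵇ-just d o xs refl | false =
  any-false d any≡ , λ x∈ys → let (x∈xs , T[not[ox]]) = ∈-filter⁻ (T? ∘ (not ∘ o)) x∈ys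
                               in x∈xs , subst T (Equivalence.to T-not-≡ T[not[ox]])

nondecisive⇒nothing : ∀ (w : Maybe Bool) → ¬ T (isJust true w) → ¬ T (isJust false w) → w ≡ nothing
nondecisive⇒nothing nothing      _    _    = refl
nondecisive⇒nothing (just true)  ¬sat _    = ⊥-elim (¬sat tt)
nondecisive⇒nothing (just false) _    ¬fal = ⊥-elim (¬fal tt)

nondecisive⇒survivingBit : ∀ κ pol c → ¬ T (decisive κ (just (if pol then c else not c))) →
  c ≡ survivingBit κ pol
nondecisive⇒survivingBit clause true  false _ = refl
nondecisive⇒survivingBit clause false true  _ = refl
nondecisive⇒survivingBit term   true  true  _ = refl
nondecisive⇒survivingBit term   false false _ = refl
nondecisive⇒survivingBit clause true  true  h = ⊥-elim (h tt)
nondecisive⇒survivingBit clause false false h = ⊥-elim (h tt)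
nondecisive⇒survivingBit term   true  false h = ⊥-elim (h tt)
nondecisive⇒survivingBit term   false true  h = ⊥-elim (h tt)

restrict-just : ∀ κ ρ A {B} → restrict κ ρ A ≡ just B →
  (∀ {l} → l ∈ A → ¬ T (decisive κ (litVal ρ l))) × (∀ {l} → l ∈ B → l ∈ A × litVal ρ l ≡ nothing)
restrict-just clause ρ A eq =
  let (A-ok , B⊆A) = if-any-filterᵇ-just (satisfiedᵇ ρ) (falsifiedᵇ ρ) A eq
  in A-ok , λ l∈B → let (l∈A , ¬fal) = B⊆A l∈B in l∈A , nondecisive⇒nothing _ (A-ok l∈A) ¬fal
restrict-just term   ρ A eq =
  let (A-ok , B⊆A) = if-any-filterᵇ-just (falsifiedᵇ ρ) (satisfiedᵇ ρ) A eq
  in A-ok , λ l∈B → let (l∈A , ¬sat) = B⊆A l∈B in l∈A , nondecisive⇒nothing _ ¬sat (A-ok l∈A)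

litVal-nothing : ∀ ρ x pol → litVal ρ (x , pol) ≡ nothing → ρ x ≡ nothing
litVal-nothing ρ x pol eq with ρ x
... | nothing = refl

litVal-just : ∀ ρ x pol {c} → ρ x ≡ just c → litVal ρ (x , pol) ≡ just (if pol then c else not c)
litVal-just ρ x pol eq with ρ x
litVal-just ρ x pol refl | just _ = refl

pigeon-inRange : ∀ {n k x v} → ValidVar n k x → v ∈ pigeonsVar x → InRange 1 n v
pigeon-inRange {x = q _ _} (v∈[n] , _) (here refl) = v∈[n]
pigeon-inRange {x = z _ _} (v∈[n] , _) (here refl) = v∈[n]

module _ {n} (lst : Vec Bool n → ℕ → ℕ) (yr : Vec Bool n → ℕ → ℕ → Bool) (S b : Vec Bool n) where

  private
    ρ : PAssign
    ρ = rho lst yr S b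

  rho-pigeon : ∀ {x v} → v ∈ pigeonsVar x → ρ x ≡ (if at S v then nothing else just (at b v))
  rho-pigeon {q _ _} (here refl) = refl
  rho-pigeon {z _ _} (here refl) = refl

  rho-pigeon-nothing : ∀ {x v} → v ∈ pigeonsVar x → ρ x ≡ nothing → at S v ≡ true
  rho-pigeon-nothing {v = v} v∈x eq with at S v | rho-pigeon v∈x
  ... | true  | _   = refl
  ... | false | eq′ with () ← trans (sym eq) eq′

  rho-pigeon-∉ : ∀ {x v} → v ∈ pigeonsVar x → at S v ≡ false → ρ x ≡ just (at b v)
  rho-pigeon-∉ {v = v} v∈x S∌v = trans (rho-pigeon v∈x) (cong (λ s → if s then nothing else just (at b v)) S∌v)

  pwRestrict-≤ : ∀ {k} κ A → All (λ l → ValidVar n k (proj₁ l)) A →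
    pwRestrict κ ρ A ≤ ones (S ∩ mentionedPigeons n A)
  pwRestrict-≤ κ A valid with restrict κ ρ A in eq
  ... | nothing = z≤n
  ... | just B  = begin
    length (deduplicate ℕ._≟_ L) ≤⟨ Unique-length-≤ (deduplicate-! L) v∈support ⟩
    length (support (S ∩ M))     ≡⟨ length-support (S ∩ M) ⟩
    ones (S ∩ M)                 ∎
    where
    open ≤-Reasoning
    L = concatMap (λ l → pigeonsVar (proj₁ l)) B
    M = mentionedPigeons n A
    v∈support : ∀ {v} → v ∈ deduplicate ℕ._≟_ L → v ∈ support (S ∩ M)
    v∈support {v} v∈L
      with _ , v∈xs , xs∈ ← ∈-concat⁻′ (map (λ l → pigeonsVar (proj₁ l)) B) (∈-deduplicate⁻ ℕ._≟_ L v∈L)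
      with (x , pol) , l∈B , refl ← ∈-map⁻ (λ l → pigeonsVar (proj₁ l)) xs∈
      with l∈A , unset ← proj₂ (restrict-just κ ρ A eq) l∈B =
      ∈-support (S ∩ M) v∈[n] (trans (at-∩ S M v) (cong₂ _∧_ S∋v M∋v))
      where
      v∈[n] = pigeon-inRange (All-lookup valid l∈A) v∈xs
      S∋v = rho-pigeon-nothing v∈xs (litVal-nothing ρ x pol unset)
      M∋v = trans (at-tabulate n (λ v → is-just (firstPolarityOn v A)) v∈[n])
                  (firstPolarityOn-complete v A l∈A v∈xs)

  pwRestrict-agreesOn : ∀ κ A → 0 < pwRestrict κ ρ A →
    T (agreesOn (∁ S ∩ mentionedPigeons n A) (survivingBits n κ A) b)
  pwRestrict-agreesOn κ A 0<pw with restrict κ ρ A in eq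
  ... | just B = agreesOn-∁∩-intro S (mentionedPigeons n A) (survivingBits n κ A) b forced
    where
    forced : ∀ v → InRange 1 n v → at S v ≡ false → at (mentionedPigeons n A) v ≡ true →
      at b v ≡ at (survivingBits n κ A) v
    forced v v∈[n] S∌v M∋v
      with pol , first ← mentioned⇒firstPolarity A v∈[n] M∋v
      with x , x∈A , v∈x ← firstPolarityOn-sound v A first =
      trans (nondecisive⇒survivingBit κ pol (at b v) nondecisive) (sym (at-survivingBits κ A v∈[n] first))
      where
      nondecisive : ¬ T (decisive κ (just (if pol then at b v else not (at b v))))
      nondecisive = subst (λ w → ¬ T (decisive κ w)) (litVal-just ρ x pol (rho-pigeon-∉ v∈x S∌v))
                          (proj₁ (restrict-just κ ρ A eq) x∈A)

-- The two bounds on the probability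

module _ {n} (k ℓ : ℕ) (lst : Vec Bool n → ℕ → ℕ) (yr : Vec Bool n → ℕ → ℕ → Bool) (κ : Kind) (A : List Lit) where

  private
    M : Vec Bool n
    M = mentionedPigeons n A

    t : ℕ
    t = ones M

    bad : Vec Bool n → Vec Bool n → Bool
    bad S b = ℓ ≤ᵇ pwRestrict κ (rho lst yr S b) A

  badCount-≡ : badCount n k ℓ lst yr κ A ≡ sumOfSize n k (λ S → count n (bad S))
  badCount-≡ = length-filterᵇ-pairs n k _

  totalCount-≡ : totalCount n k ≡ n choose k * 2 ^ n
  totalCount-≡ = cong (_* 2 ^ n) (length-subsetsOfSize n k)

  -- A non-trivial A|ρ forces b_v for each of the at least t - k pigeons v ∈ M ∖ S.
  count-bad-*-2^-≤ : 0 < ℓ → ∀ S → ones S ≡ k → count n (bad S) * 2 ^ t ≤ 2 ^ k * 2 ^ n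
  count-bad-*-2^-≤ 0<ℓ S |S|≡k = begin
    count n (bad S) * 2 ^ t               ≡⟨ cong (λ e → count n (bad S) * 2 ^ e) (ones-split S M) ⟩
    count n (bad S) * 2 ^ (a + d)         ≡⟨ cong (count n (bad S) *_) (^-distribˡ-+-* 2 a d) ⟩
    count n (bad S) * (2 ^ a * 2 ^ d)     ≡⟨ solve 3 (λ a b c → a :* (b :* c) := b :* (a :* c)) refl (count n (bad S)) (2 ^ a) (2 ^ d) ⟩
    2 ^ a * (count n (bad S) * 2 ^ d)     ≤⟨ *-mono-≤ (^-monoʳ-≤ 2 a≤k) (*-monoˡ-≤ (2 ^ d) bad⇒agree) ⟩
    2 ^ k * (count n (agreesOn D C) * 2 ^ d) ≡⟨ cong (2 ^ k *_) (count-agreesOn D C) ⟩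
    2 ^ k * 2 ^ n                         ∎
    where
    open ≤-Reasoning
    D = ∁ S ∩ M
    C = survivingBits n κ A
    a = ones (S ∩ M)
    d = ones D
    a≤k : a ≤ k
    a≤k = ≤-trans (ones-∩-≤ S M) (≤-reflexive |S|≡k)
    bad⇒agree : count n (bad S) ≤ count n (agreesOn D C)
    bad⇒agree = count-mono n (λ b ℓ≤pw → pwRestrict-agreesOn lst yr S b κ A
                                            (<-≤-trans 0<ℓ (≤ᵇ⇒≤ ℓ _ ℓ≤pw)))

  badCount-*-2^-≤ : 0 < ℓ → badCount n k ℓ lst yr κ A * 2 ^ t ≤ 2 ^ k * totalCount n k
  badCount-*-2^-≤ 0<ℓ = begin
    badCount n k ℓ lst yr κ A * 2 ^ t                   ≡⟨ cong (_* 2 ^ t) badCount-≡ ⟩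
    sumOfSize n k (λ S → count n (bad S)) * 2 ^ t       ≡⟨ sumOfSize-*ʳ n k _ (2 ^ t) ⟩
    sumOfSize n k (λ S → count n (bad S) * 2 ^ t)       ≤⟨ sumOfSize-mono n k (count-bad-*-2^-≤ 0<ℓ) ⟩
    sumOfSize n k (λ _ → 2 ^ k * 2 ^ n)                 ≡⟨ sumOfSize-const n k _ ⟩
    2 ^ k * 2 ^ n * n choose k                          ≡⟨ solve 3 (λ a b c → a :* b :* c := a :* (c :* b)) refl (2 ^ k) (2 ^ n) (n choose k) ⟩
    2 ^ k * (n choose k * 2 ^ n)                        ≡⟨ cong (2 ^ k *_) totalCount-≡ ⟨
    2 ^ k * totalCount n k                              ∎
    where open ≤-Reasoning

  count-bad-≤ : ∀ {k′} → All (λ l → ValidVar n k′ (proj₁ l)) A →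
    ∀ S → count n (bad S) ≤ ones (S ∩ M) choose ℓ * 2 ^ n
  count-bad-≤ valid S = begin
    count n (bad S)                          ≤⟨ sumAll-mono n (λ b → 𝟙[≤ᵇ]-≤-choose ℓ (pwRestrict-≤ lst yr S b κ A valid)) ⟩
    sumAll n (λ _ → ones (S ∩ M) choose ℓ)   ≡⟨ sumAll-const n _ ⟩
    ones (S ∩ M) choose ℓ * 2 ^ n            ∎
    where open ≤-Reasoning

  badCount-*-^-≤ : ∀ {k′} → All (λ l → ValidVar n k′ (proj₁ l)) A →
    badCount n k ℓ lst yr κ A * n ^ ℓ ≤ t ^ ℓ * 2 ^ k * totalCount n k
  badCount-*-^-≤ valid = begin
    badCount n k ℓ lst yr κ A * n ^ ℓ
      ≡⟨ cong (_* n ^ ℓ) badCount-≡ ⟩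
    sumOfSize n k (λ S → count n (bad S)) * n ^ ℓ
      ≤⟨ *-monoˡ-≤ (n ^ ℓ) (sumOfSize-mono n k (λ S _ → count-bad-≤ valid S)) ⟩
    sumOfSize n k (λ S → F S * 2 ^ n) * n ^ ℓ
      ≡⟨ cong (_* n ^ ℓ) (sumOfSize-*ʳ n k F (2 ^ n)) ⟨
    sumOfSize n k F * 2 ^ n * n ^ ℓ
      ≡⟨ solve 3 (λ a b c → a :* b :* c := a :* c :* b) refl (sumOfSize n k F) (2 ^ n) (n ^ ℓ) ⟩
    sumOfSize n k F * n ^ ℓ * 2 ^ n
      ≤⟨ *-monoˡ-≤ (2 ^ n) (sumOfSize-choose-∩-≤ n k ℓ M) ⟩
    t ^ ℓ * 2 ^ k * n choose k * 2 ^ n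
      ≡⟨ trans (cong (t ^ ℓ * 2 ^ k *_) totalCount-≡) (sym (*-assoc (t ^ ℓ * 2 ^ k) _ _)) ⟨
    t ^ ℓ * 2 ^ k * totalCount n k ∎
    where
    open ≤-Reasoning
    F : Vec Bool n → ℕ
    F S = ones (S ∩ M) choose ℓ

-- Arithmetic

m^a≤m^b⇒a≤b : ∀ {m a b} → 1 < m → m ^ a ≤ m ^ b → a ≤ b
m^a≤m^b⇒a≤b {m} {a} {b} 1<m m^a≤m^b with a ≤? b
... | yes a≤b = a≤b
... | no  a≰b = contradiction m^a≤m^b (<⇒≱ (^-monoʳ-< m 1<m (≰⇒> a≰b)))

*-^-distrib : ∀ m n o → (m * n) ^ o ≡ m ^ o * n ^ o
*-^-distrib m n zero    = refl
*-^-distrib m n (suc o) = trans (cong (m * n *_) (*-^-distrib m n o))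
  (solve 4 (λ a b c d → a :* b :* (c :* d) := a :* c :* (b :* d)) refl m n (m ^ o) (n ^ o))

^-monoˡ-≤-if-pos : ∀ {a b} m → (0 < m → a ≤ b) → a ^ m ≤ b ^ m
^-monoˡ-≤-if-pos zero    _   = ≤-refl
^-monoˡ-≤-if-pos (suc m) a≤b = ^-monoˡ-≤ (suc m) (a≤b (s≤s z≤n))

^-split : ∀ {ℓ k} t c → ℓ ≤ k → t ^ ℓ * c ^ k ≡ (t * c) ^ ℓ * c ^ (k ∸ ℓ)
^-split {ℓ} {k} t c ℓ≤k = begin
  t ^ ℓ * c ^ k                   ≡⟨ cong (λ e → t ^ ℓ * c ^ e) (m+[n∸m]≡n ℓ≤k) ⟨
  t ^ ℓ * c ^ (ℓ + (k ∸ ℓ))       ≡⟨ cong (t ^ ℓ *_) (^-distribˡ-+-* c ℓ (k ∸ ℓ)) ⟩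
  t ^ ℓ * (c ^ ℓ * c ^ (k ∸ ℓ))   ≡⟨ *-assoc (t ^ ℓ) _ _ ⟨
  t ^ ℓ * c ^ ℓ * c ^ (k ∸ ℓ)     ≡⟨ cong (_* c ^ (k ∸ ℓ)) (*-^-distrib t c ℓ) ⟨
  (t * c) ^ ℓ * c ^ (k ∸ ℓ)       ∎
  where open ≡-Reasoning

P≤4kP : ∀ {k} P → 0 < k → P ≤ 4 * k * P
P≤4kP {k} P 0<k = ≤-trans (m≤n*m P k {{>-nonZero 0<k}}) (*-monoˡ-≤ P (m≤n*m k 4))

^-≤-[4kP]^ : ∀ {P Q} k → Q ≤ P → Q ^ k ≤ (4 * k * P) ^ k
^-≤-[4kP]^ {P} k Q≤P = ^-monoˡ-≤-if-pos k (λ 0<k → ≤-trans Q≤P (P≤4kP P 0<k))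

-- t ≤ k + ℓ log n, in the form t Q ≤ k Q + ℓ P for every P / Q ≥ log n
exponent-≤ : ∀ {t k ℓ n P Q} → 2 ^ t ≤ 2 ^ k * n ^ ℓ → n ^ Q ≤ 2 ^ P → t * Q ≤ k * Q + ℓ * P
exponent-≤ {t} {k} {ℓ} {n} {P} {Q} 2^t≤ n^Q≤2^P = m^a≤m^b⇒a≤b {2} ≤-refl (begin
  2 ^ (t * Q)                    ≡⟨ ^-*-assoc 2 t Q ⟨
  (2 ^ t) ^ Q                    ≤⟨ ^-monoˡ-≤ Q 2^t≤ ⟩
  (2 ^ k * n ^ ℓ) ^ Q            ≡⟨ *-^-distrib (2 ^ k) (n ^ ℓ) Q ⟩
  (2 ^ k) ^ Q * (n ^ ℓ) ^ Q      ≡⟨ cong₂ _*_ (^-*-assoc 2 k Q) (trans (^-*-assoc n ℓ Q) (trans (cong (n ^_) (*-comm ℓ Q)) (sym (^-*-assoc n Q ℓ)))) ⟩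
  2 ^ (k * Q) * (n ^ Q) ^ ℓ      ≤⟨ *-monoʳ-≤ (2 ^ (k * Q)) (^-monoˡ-≤ ℓ n^Q≤2^P) ⟩
  2 ^ (k * Q) * (2 ^ P) ^ ℓ      ≡⟨ cong (2 ^ (k * Q) *_) (trans (^-*-assoc 2 P ℓ) (cong (2 ^_) (*-comm P ℓ))) ⟩
  2 ^ (k * Q) * 2 ^ (ℓ * P)      ≡⟨ ^-distribˡ-+-* 2 (k * Q) (ℓ * P) ⟨
  2 ^ (k * Q + ℓ * P)            ∎)
  where open ≤-Reasoning

t^ℓ*2^k*Q^k-≤ : ∀ {t k ℓ P Q} → ℓ ≤ k → Q ≤ P → (0 < ℓ → t * Q ≤ k * Q + ℓ * P) →
  t ^ ℓ * 2 ^ k * Q ^ k ≤ (4 * k * P) ^ k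
t^ℓ*2^k*Q^k-≤ {t} {k} {ℓ} {P} {Q} ℓ≤k Q≤P tQ≤ = begin
  t ^ ℓ * 2 ^ k * Q ^ k                 ≡⟨ trans (cong (t ^ ℓ *_) (*-^-distrib 2 Q k)) (sym (*-assoc (t ^ ℓ) _ _)) ⟨
  t ^ ℓ * (2 * Q) ^ k                   ≡⟨ ^-split t (2 * Q) ℓ≤k ⟩
  (t * (2 * Q)) ^ ℓ * (2 * Q) ^ (k ∸ ℓ) ≤⟨ *-mono-≤ (^-monoˡ-≤-if-pos ℓ 2tQ≤X) (^-monoˡ-≤-if-pos (k ∸ ℓ) 2Q≤X) ⟩
  X ^ ℓ * X ^ (k ∸ ℓ)                   ≡⟨ ^-distribˡ-+-* X ℓ (k ∸ ℓ) ⟨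
  X ^ (ℓ + (k ∸ ℓ))                     ≡⟨ cong (X ^_) (m+[n∸m]≡n ℓ≤k) ⟩
  X ^ k                                 ∎
  where
  open ≤-Reasoning
  X = 4 * k * P
  2tQ≤X : 0 < ℓ → t * (2 * Q) ≤ X
  2tQ≤X 0<ℓ = begin
    t * (2 * Q)        ≡⟨ solve 2 (λ a b → a :* (con 2 :* b) := con 2 :* (a :* b)) refl t Q ⟩
    2 * (t * Q)        ≤⟨ *-monoʳ-≤ 2 (≤-trans (tQ≤ 0<ℓ) (+-mono-≤ (*-monoʳ-≤ k Q≤P) (*-monoˡ-≤ P ℓ≤k))) ⟩
    2 * (k * P + k * P) ≡⟨ solve 2 (λ a b → con 2 :* (a :* b :+ a :* b) := con 4 :* a :* b) refl k P ⟩
    X                  ∎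
  2Q≤X : 0 < k ∸ ℓ → 2 * Q ≤ X
  2Q≤X 0<k∸ℓ = begin
    2 * Q        ≤⟨ *-monoʳ-≤ 2 (≤-trans Q≤P (m≤n*m P k {{>-nonZero (<-≤-trans 0<k∸ℓ (m∸n≤m k ℓ))}})) ⟩
    2 * (k * P)  ≤⟨ *-monoˡ-≤ (k * P) {2} {4} (s≤s (s≤s z≤n)) ⟩
    4 * (k * P)  ≡⟨ *-assoc 4 k P ⟨
    X            ∎

tail-bound : ∀ {a b t k ℓ n P Q} → 2 ≤ n → ℓ ≤ k → n ^ Q < 2 ^ P →
  (0 < ℓ → a * 2 ^ t ≤ 2 ^ k * b) → a * n ^ ℓ ≤ t ^ ℓ * 2 ^ k * b →
  a * n ^ ℓ * Q ^ k ≤ (4 * k * P) ^ k * b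
tail-bound {a} {b} {t} {k} {ℓ} {n} {P} {Q} 2≤n ℓ≤k n^Q<2^P few⇒ many⇒ =
  byCases (2 ^ k * n ^ ℓ ≤? 2 ^ t) (0 <? ℓ)
  where
  open ≤-Reasoning
  Q≤P : Q ≤ P
  Q≤P = m^a≤m^b⇒a≤b {2} ≤-refl (≤-trans (^-monoˡ-≤ Q 2≤n) (<⇒≤ n^Q<2^P))

  viaFew : 2 ^ k * n ^ ℓ ≤ 2 ^ t → 0 < ℓ → a * n ^ ℓ * Q ^ k ≤ (4 * k * P) ^ k * b
  viaFew few 0<ℓ = begin
    a * n ^ ℓ * Q ^ k        ≤⟨ *-mono-≤ a*n^ℓ≤b (^-≤-[4kP]^ k Q≤P) ⟩
    b * (4 * k * P) ^ k      ≡⟨ *-comm b _ ⟩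
    (4 * k * P) ^ k * b      ∎
    where
    a*n^ℓ≤b : a * n ^ ℓ ≤ b
    a*n^ℓ≤b = *-cancelʳ-≤ _ _ (2 ^ k) {{m^n≢0 2 k}} (begin
      a * n ^ ℓ * 2 ^ k      ≡⟨ trans (*-assoc a _ _) (cong (a *_) (*-comm (n ^ ℓ) (2 ^ k))) ⟩
      a * (2 ^ k * n ^ ℓ)    ≤⟨ *-monoʳ-≤ a few ⟩
      a * 2 ^ t              ≤⟨ few⇒ 0<ℓ ⟩
      2 ^ k * b              ≡⟨ *-comm (2 ^ k) b ⟩
      b * 2 ^ k              ∎)

  viaMany : (0 < ℓ → t * Q ≤ k * Q + ℓ * P) → a * n ^ ℓ * Q ^ k ≤ (4 * k * P) ^ k * b
  viaMany tQ≤ = begin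
    a * n ^ ℓ * Q ^ k              ≤⟨ *-monoˡ-≤ (Q ^ k) many⇒ ⟩
    t ^ ℓ * 2 ^ k * b * Q ^ k      ≡⟨ solve 3 (λ a b c → a :* b :* c := a :* c :* b) refl (t ^ ℓ * 2 ^ k) b (Q ^ k) ⟩
    t ^ ℓ * 2 ^ k * Q ^ k * b      ≤⟨ *-monoˡ-≤ b (t^ℓ*2^k*Q^k-≤ ℓ≤k Q≤P tQ≤) ⟩
    (4 * k * P) ^ k * b            ∎

  byCases : Dec (2 ^ k * n ^ ℓ ≤ 2 ^ t) → Dec (0 < ℓ) → a * n ^ ℓ * Q ^ k ≤ (4 * k * P) ^ k * b
  byCases (yes few)  (yes 0<ℓ) = viaFew few 0<ℓ
  byCases (yes _)    (no  ℓ≯0) = viaMany (λ 0<ℓ → contradiction 0<ℓ ℓ≯0)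
  byCases (no  ¬few) _         = viaMany (λ _ → exponent-≤ {t} {k} {ℓ} (<⇒≤ (≰⇒> ¬few)) (<⇒≤ n^Q<2^P))

FracLeCLogPow-intro : ∀ {a b c n k} → (∀ P Q → n ^ Q < 2 ^ P → a * Q ^ k ≤ (c * P) ^ k * b) →
  FracLeCLogPow a b c n k
FracLeCLogPow-intro {a} {b} {c} {n} {k} bound P Q _ lhs<rhs with 2 ^ P ≤? n ^ Q
... | yes 2^P≤n^Q = 2^P≤n^Q
... | no  2^P≰n^Q = contradiction (bound P Q (≰⇒> 2^P≰n^Q)) (<⇒≱ (subst (_< a * Q ^ k) reorder lhs<rhs))
  where
  reorder : P ^ k * c ^ k * b ≡ (c * P) ^ k * b
  reorder = cong (_* b) (trans (*-comm (P ^ k) (c ^ k)) (sym (*-^-distrib c P k)))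

lemma3p2 : ∀ (k ℓ n : ℕ) → 16 ≤ n → ℓ ≤ k → n ^ (4 * k) ≤ 2 ^ n →
    (lst : Vec Bool n → ℕ → ℕ) → ListingRule n k lst →
    (yr : Vec Bool n → ℕ → ℕ → Bool) → YRuleOK n k lst yr →
    (κ : Kind) (A : List Lit) → All (λ l → ValidVar n k (proj₁ l)) A →
    FracLeCLogPow (badCount n k ℓ lst yr κ A * n ^ ℓ) (totalCount n k) (4 * k) n k
lemma3p2 k ℓ n 16≤n ℓ≤k _ lst _ yr _ κ A valid =
  FracLeCLogPow-intro {bad * n ^ ℓ} {total} {4 * k} {n} {k} λ P Q n^Q<2^P →
    tail-bound {a = bad} {b = total} {t = ones (mentionedPigeons n A)} {P = P} {Q = Q}
      (≤-trans (s≤s (s≤s z≤n)) 16≤n) ℓ≤k n^Q<2^P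
      (badCount-*-2^-≤ k ℓ lst yr κ A) (badCount-*-^-≤ k ℓ lst yr κ A valid)
  where
  bad   = badCount n k ℓ lst yr κ A
  total = totalCount n k
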